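{- If $G$ is a finite, simple, connected, uniquely dimensional graph of order $n$ containing a cycle, and $g$ is the girth of $G$, then $\beta(G)\leq n-g+1$.
   Context: For vertices $u,v$ of a connected graph $G$, $d(u,v)$ is the distance between them. For an ordered set $W=\{w_1,\dots,w_k\}\subseteq V(G)$ and $v\in V(G)$, $r(v|W)=(d(v,w_1),\dots,d(v,w_k))$. $W$ is a resolving set if distinct vertices have distinct representations $r(\cdot|W)$. A resolving set of minimum cardinality is a metric basis; its cardinality is the metric dimension $\beta(G)$. $G$ is uniquely dimensional if it has exactly one metric basis. The girth is the length of a shortest cycle. -}

module Defs where

open import Data.Nat using (ℕ; zero; suc; _≤_)
open import Data.Fin using (Fin; zero; suc; inject₁; fromℕ)
open import Data.Fin.Subset using (Subset; _∈_; ∣_∣)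
open import Data.Bool using (Bool; T)
open import Data.Product using (Σ; ∃; _×_)
open import Relation.Binary.PropositionalEquality using (_≡_)
open import Relation.Nullary using (¬_)
open import Function.Definitions using (Injective)

record Graph (n : ℕ) : Set where
  field
    adj   : Fin n → Fin n → Bool
    sym   : ∀ u v → adj u v ≡ adj v u
    irref : ∀ u → ¬ T (adj u u)

module _ {n : ℕ} (G : Graph n) where
  open Graph G

  Adj : Fin n → Fin n → Set
  Adj u v = T (adj u v)

  data Walk : Fin n → Fin n → ℕ → Set where
    here : ∀ {u} → Walk u u zero
    step : ∀ {u w v k} → Adj u w → Walk w v k → Walk u v (suc k)

  Connected : Set
  Connected = ∀ u v → ∃ λ k → Walk u v k

  IsDist : Fin n → Fin n → ℕ → Set
  IsDist u v k = Walk u v k × (∀ m → Walk u v m → k ≤ m)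

  Resolving : Subset n → Set
  Resolving W = ∀ u v →
    (∀ w → w ∈ W → ∀ k → IsDist u w k → IsDist v w k) → u ≡ v

  MetricBasis : Subset n → Set
  MetricBasis W = Resolving W × (∀ W′ → Resolving W′ → ∣ W ∣ ≤ ∣ W′ ∣)

  MetricDim : ℕ → Set
  MetricDim b = Σ (Subset n) λ W → MetricBasis W × ∣ W ∣ ≡ b

  UniquelyDimensional : Set
  UniquelyDimensional =
    Σ (Subset n) λ B → MetricBasis B × (∀ B′ → MetricBasis B′ → B′ ≡ B)

  HasCycle : ℕ → Set
  HasCycle zero = Data.Empty.⊥
    where import Data.Empty
  HasCycle (suc m) = (2 ≤ m) × Σ (Fin (suc m) → Fin n) λ f →
    Injective _≡_ _≡_ f × (∀ (i : Fin m) → Adj (f (inject₁ i)) (f (suc i)))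
      × Adj (f (fromℕ m)) (f zero)

  Girth : ℕ → Set
  Girth g = HasCycle g × (∀ h → HasCycle h → g ≤ h)

-- Let c₀ c₁ … c_{g-1} be a shortest cycle. Two different paths between the same vertices whose
-- lengths add up to less than g would close a cycle shorter than g, so an arc of the cycle of length
-- t cannot be undercut by a walk of length d with t + d < g; hence distances between cycle vertices
-- are distances along the cycle. On a cycle, two adjacent vertices already distinguish all vertices
-- by their distances. Deleting c₁, …, c_{g-2} therefore leaves a resolving set of n - g + 2
-- vertices (each of its own members is singled out by distance 0). If β(G) ≥ n - g + 2 it is a
-- metric basis, and so is the set obtained from the rotated cycle c₁ c₂ … c₀; the two differ at c₁,
-- contradicting uniqueness.

module Submission where

open import Defs
open import Data.Nat using (ℕ; zero; suc; _+_; _*_; _∸_; _⊓_; _≤_; _<_; z≤n; s≤s; _≤?_; _<?_; NonZero; >-nonZero)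
open import Data.Nat.Properties hiding (_≟_)
open import Data.Nat.DivMod using (_%_; _/_; m%n<n; m≡m%n+[m/n]*n; [m+n]%n≡m%n; [m+kn]%n≡m%n; m<n⇒m%n≡m; n%n≡0)
open import Data.Nat.Divisibility using (_∣_; divides; ∣⇒≤)
open import Data.Fin using (Fin; zero; suc; toℕ; fromℕ; fromℕ<; inject₁)
open import Data.Fin.Properties using (_≟_; toℕ-injective; toℕ-fromℕ<; toℕ-fromℕ; toℕ-inject₁; injective⇒≤; any?)
open import Data.Fin.Subset using (Subset; ⊤; _-_; ∣_∣) renaming (_∈_ to _∈ₛ_; _∉_ to _∉ₛ_)
open import Data.Fin.Subset.Properties using (∈⊤; ∣⊤∣≡n; x∈p∧x≢y⇒x∈p-y; p─q⊆p; x∈p⇒∣p-x∣<∣p∣) renaming (_∈?_ to _∈ₛ?_)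
open import Data.List using (List; []; _∷_; length; applyUpTo)
open import Data.List.Properties using (length-applyUpTo)
open import Data.List.Membership.Propositional using (_∈_; _∉_)
open import Data.List.Membership.Propositional.Properties using (∈-applyUpTo⁺; ∈-applyUpTo⁻)
open import Data.List.Relation.Unary.All as All using (All; []; _∷_)
open import Data.List.Relation.Unary.All.Properties using (¬Any⇒All¬; All¬⇒¬Any; anti-mono)
open import Data.List.Relation.Unary.Any using (here; there)
open import Data.List.Relation.Unary.Unique.Propositional using (Unique)
open import Data.List.Relation.Unary.Unique.Propositional.Properties using (applyUpTo⁺₁; Unique[x∷xs]⇒x∉xs)
open import Data.List.Relation.Binary.Subset.Propositional using (_⊆_)
open import Data.List.Relation.Binary.Subset.Propositional.Properties using (∷⁺ʳ)
open import Data.List.Relation.Unary.AllPairs using ([]; _∷_; tail)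
import Data.Vec as Vec
open import Data.Product using (Σ; ∃; ∃₂; _×_; _,_; proj₁; proj₂)
open import Data.Sum using (inj₁; inj₂)
open import Data.Empty using (⊥; ⊥-elim)
open import Data.Bool using (T; T?)
open import Function using (_∘_; id)
open import Function.Definitions using (Injective)
open import Relation.Nullary using (Dec; yes; no; contradiction)
open import Relation.Nullary.Decidable using (_×-dec_)
open import Relation.Unary using (Decidable)
open import Relation.Binary.PropositionalEquality

least-witness : ∀ {P : ℕ → Set} → Decidable P → ∀ {k} → P k → ∃ λ j → P j × (∀ m → P m → j ≤ m)
least-witness P? pk with P? 0
... | yes p0 = 0 , p0 , λ _ _ → z≤n
least-witness P? {zero} pk | no ¬p0 = contradiction pk ¬p0
least-witness P? {suc k} pk | no ¬p0 with least-witness (P? ∘ suc) pk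
... | j , pj , least = suc j , pj , λ where
  zero p0 → contradiction p0 ¬p0
  (suc m) pm → s≤s (least m pm)

%-cong⇒∣∸ : ∀ {i j} g .{{_ : NonZero g}} → i % g ≡ j % g → g ∣ j ∸ i
%-cong⇒∣∸ {i} {j} g i%g≡j%g = divides (j / g ∸ i / g) (begin
  j ∸ i                                    ≡⟨ cong₂ _∸_ (m≡m%n+[m/n]*n j g) (m≡m%n+[m/n]*n i g) ⟩
  (j % g + j / g * g) ∸ (i % g + i / g * g) ≡⟨ cong (λ r → (j % g + j / g * g) ∸ (r + i / g * g)) i%g≡j%g ⟩
  (j % g + j / g * g) ∸ (j % g + i / g * g) ≡⟨ [m+n]∸[m+o]≡n∸o (j % g) _ _ ⟩
  j / g * g ∸ i / g * g                    ≡⟨ *-distribʳ-∸ g (j / g) (i / g) ⟨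
  (j / g ∸ i / g) * g                      ∎)
  where open ≡-Reasoning

%-injective-window : ∀ {i j} g .{{_ : NonZero g}} → i < j → j < i + g → i % g ≢ j % g
%-injective-window {i} {j} g i<j j<i+g i%g≡j%g = <⇒≱ (m<n+o⇒m∸n<o j i j<i+g)
  (∣⇒≤ {{>-nonZero (m<n⇒0<n∸m i<j)}} (%-cong⇒∣∸ g i%g≡j%g))

[1+m]%n≡[1+m%n]%n : ∀ m n .{{_ : NonZero n}} → suc m % n ≡ suc (m % n) % n
[1+m]%n≡[1+m%n]%n m n = begin
  suc m % n                     ≡⟨ cong (λ x → suc x % n) (m≡m%n+[m/n]*n m n) ⟩
  (suc (m % n) + m / n * n) % n ≡⟨ [m+kn]%n≡m%n (suc (m % n)) (m / n) n ⟩
  suc (m % n) % n               ∎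
  where open ≡-Reasoning

m⊓[2+n]≡n⊓[2+m]⇒m≡n : ∀ m n → m ⊓ suc (suc n) ≡ n ⊓ suc (suc m) → m ≡ n
m⊓[2+n]≡n⊓[2+m]⇒m≡n zero zero _ = refl
m⊓[2+n]≡n⊓[2+m]⇒m≡n zero (suc n) ()
m⊓[2+n]≡n⊓[2+m]⇒m≡n (suc m) zero ()
m⊓[2+n]≡n⊓[2+m]⇒m≡n (suc m) (suc n) eq = cong suc (m⊓[2+n]≡n⊓[2+m]⇒m≡n m n (suc-injective eq))

mirrored-landmark-positions : ∀ {i e j e′} → e + i ≡ e′ + j → i ≡ suc e′ → e ⊓ suc i ≡ e′ ⊓ suc j → i ≡ j
mirrored-landmark-positions {e = e} {j} {e′} sum refl d₁ = trans (cong suc (sym e≡e′)) (sym j≡1+e)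
  where
  j≡1+e : j ≡ suc e
  j≡1+e = +-cancelˡ-≡ e′ j (suc e) (begin
    e′ + j       ≡⟨ sum ⟨
    e + suc e′   ≡⟨ +-suc e e′ ⟩
    suc (e + e′) ≡⟨ cong suc (+-comm e e′) ⟩
    suc (e′ + e) ≡⟨ +-suc e′ e ⟨
    e′ + suc e   ∎)
    where open ≡-Reasoning
  e≡e′ : e ≡ e′
  e≡e′ = m⊓[2+n]≡n⊓[2+m]⇒m≡n e e′ (trans d₁ (cong (λ x → e′ ⊓ suc x) j≡1+e))

-- On a cycle of length e + i + 1, the vertex at position i has distance (1 + e) ⊓ i to position 0
-- and e ⊓ (1 + i) to the adjacent position e + i.
two-adjacent-landmarks-resolve : ∀ {i e j e′} → e + i ≡ e′ + j →
  suc e ⊓ i ≡ suc e′ ⊓ j → e ⊓ suc i ≡ e′ ⊓ suc j → i ≡ j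
two-adjacent-landmarks-resolve {i} {e} {j} {e′} sum d₀ d₁ with ≤-total i (suc e) | ≤-total j (suc e′)
... | inj₁ i≤ | inj₁ j≤ = trans (sym (m≥n⇒m⊓n≡n i≤)) (trans d₀ (m≥n⇒m⊓n≡n j≤))
... | inj₂ ≤i | inj₂ ≤j = +-cancelˡ-≡ e i j (trans sum (cong (_+ j) (sym e≡e′)))
  where
  e≡e′ : e ≡ e′
  e≡e′ = suc-injective (trans (sym (m≤n⇒m⊓n≡m ≤i)) (trans d₀ (m≤n⇒m⊓n≡m ≤j)))
... | inj₁ i≤ | inj₂ ≤j =
  mirrored-landmark-positions sum (trans (sym (m≥n⇒m⊓n≡n i≤)) (trans d₀ (m≤n⇒m⊓n≡m ≤j))) d₁
... | inj₂ ≤i | inj₁ j≤ =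
  sym (mirrored-landmark-positions (sym sum) (trans (sym (m≥n⇒m⊓n≡n j≤)) (trans (sym d₀) (m≤n⇒m⊓n≡m ≤i))) (sym d₁))

_∖_ : ∀ {n} → Subset n → List (Fin n) → Subset n
p ∖ [] = p
p ∖ (x ∷ xs) = (p ∖ xs) - x

x∉p-x : ∀ {n} (p : Subset n) x → x ∉ₛ p - x
x∉p-x (_ Vec.∷ _) zero ()
x∉p-x (_ Vec.∷ p) (suc x) (Vec.there x∈p-x) = x∉p-x p x x∈p-x

module _ {n : ℕ} where

  ∈-∖⁺ : ∀ {p : Subset n} {x} xs → x ∈ₛ p → x ∉ xs → x ∈ₛ p ∖ xs
  ∈-∖⁺ [] x∈p _ = x∈p
  ∈-∖⁺ (y ∷ ys) x∈p x∉y∷ys = x∈p∧x≢y⇒x∈p-y (∈-∖⁺ ys x∈p (x∉y∷ys ∘ there)) (x∉y∷ys ∘ here)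

  ∈⇒∉-∖ : ∀ (p : Subset n) {x xs} → x ∈ xs → x ∉ₛ p ∖ xs
  ∈⇒∉-∖ p {xs = x ∷ xs} (here refl) = x∉p-x (p ∖ xs) x
  ∈⇒∉-∖ p {xs = y ∷ xs} (there x∈xs) = ∈⇒∉-∖ p x∈xs ∘ p─q⊆p (p ∖ xs) _

  ∉-∖⁻ : ∀ {p : Subset n} {x} xs → x ∈ₛ p → x ∉ₛ p ∖ xs → x ∈ xs
  ∉-∖⁻ [] x∈p x∉p = contradiction x∈p x∉p
  ∉-∖⁻ {x = x} (y ∷ ys) x∈p x∉p∖xs with x ≟ y
  ... | yes x≡y = here x≡y
  ... | no x≢y = there (∉-∖⁻ ys x∈p (x∉p∖xs ∘ λ x∈ → x∈p∧x≢y⇒x∈p-y x∈ x≢y))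

  ∣∖∣+length≤∣∣ : ∀ (p : Subset n) {xs} → Unique xs → All (_∈ₛ p) xs → ∣ p ∖ xs ∣ + length xs ≤ ∣ p ∣
  ∣∖∣+length≤∣∣ p {[]} _ _ = ≤-reflexive (+-identityʳ ∣ p ∣)
  ∣∖∣+length≤∣∣ p {x ∷ xs} (x∉xs ∷ xs!) (x∈p ∷ xs⊆p) = begin
    ∣ (p ∖ xs) - x ∣ + suc (length xs) ≡⟨ +-suc _ (length xs) ⟩
    suc ∣ (p ∖ xs) - x ∣ + length xs   ≤⟨ +-monoˡ-≤ (length xs) (x∈p⇒∣p-x∣<∣p∣ x∈p∖xs) ⟩
    ∣ p ∖ xs ∣ + length xs             ≤⟨ ∣∖∣+length≤∣∣ p xs! xs⊆p ⟩
    ∣ p ∣                              ∎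
    where
    open ≤-Reasoning
    x∈p∖xs = ∈-∖⁺ xs x∈p (All¬⇒¬Any x∉xs)

module _ {n : ℕ} (G : Graph n) where

  open import Data.List.Membership.DecPropositional {A = Fin n} _≟_ using (_∈?_)

  private variable
    u v w x : Fin n
    k l : ℕ

  adj-sym : Adj G u v → Adj G v u
  adj-sym {u} {v} = subst T (Graph.sym G u v)

  adj⇒≢ : Adj G u v → u ≢ v
  adj⇒≢ u~u refl = Graph.irref G _ u~u

  walk₀⇒≡ : Walk G u v 0 → u ≡ v
  walk₀⇒≡ here = refl

  walk-snoc : Walk G u v k → Adj G v w → Walk G u w (suc k)
  walk-snoc here v~w = step v~w here
  walk-snoc (step u~x W) v~w = step u~x (walk-snoc W v~w)

  walk-reverse : Walk G u v k → Walk G v u k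
  walk-reverse here = here
  walk-reverse (step u~x W) = walk-snoc (walk-reverse W) (adj-sym u~x)

  walk-along : (f : ℕ → Fin n) → (∀ d → Adj G (f d) (f (suc d))) → ∀ t → Walk G (f 0) (f t) t
  walk-along f f~ zero = here
  walk-along f f~ (suc t) = step (f~ 0) (walk-along (f ∘ suc) (f~ ∘ suc) t)

  vertices : Walk G u v k → List (Fin n)
  vertices {u} here = u ∷ []
  vertices {u} (step _ W) = u ∷ vertices W

  IsPath : Walk G u v k → Set
  IsPath W = Unique (vertices W)

  end∈vertices : (W : Walk G u v k) → v ∈ vertices W
  end∈vertices here = here refl
  end∈vertices (step _ W) = there (end∈vertices W)

  vertices-walk-along : ∀ f f~ t → vertices (walk-along f f~ t) ≡ applyUpTo f (suc t)
  vertices-walk-along f f~ zero = refl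
  vertices-walk-along f f~ (suc t) = cong (f 0 ∷_) (vertices-walk-along (f ∘ suc) (f~ ∘ suc) t)

  vertexAt : Walk G u v k → Fin (suc k) → Fin n
  vertexAt {u} _ zero = u
  vertexAt (step _ W) (suc i) = vertexAt W i

  vertexAt∈vertices : (W : Walk G u v k) (i : Fin (suc k)) → vertexAt W i ∈ vertices W
  vertexAt∈vertices here zero = here refl
  vertexAt∈vertices (step _ W) zero = here refl
  vertexAt∈vertices (step _ W) (suc i) = there (vertexAt∈vertices W i)

  vertexAt-injective : (W : Walk G u v k) → IsPath W → Injective _≡_ _≡_ (vertexAt W)
  vertexAt-injective W _ {zero} {zero} _ = refl
  vertexAt-injective (step _ W) (u∉W ∷ _) {zero} {suc j} u≡ =
    ⊥-elim (All.lookup u∉W (vertexAt∈vertices W j) u≡)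
  vertexAt-injective (step _ W) (u∉W ∷ _) {suc i} {zero} ≡u =
    ⊥-elim (All.lookup u∉W (vertexAt∈vertices W i) (sym ≡u))
  vertexAt-injective (step _ W) (_ ∷ W!) {suc i} {suc j} eq = cong suc (vertexAt-injective W W! eq)

  vertexAt-adjacent : (W : Walk G u v k) (i : Fin k) → Adj G (vertexAt W (inject₁ i)) (vertexAt W (suc i))
  vertexAt-adjacent (step u~x _) zero = u~x
  vertexAt-adjacent (step _ W) (suc i) = vertexAt-adjacent W i

  vertexAt-last : (W : Walk G u v k) → vertexAt W (fromℕ k) ≡ v
  vertexAt-last here = refl
  vertexAt-last (step _ W) = vertexAt-last W

  path-closing-cycle : (W : Walk G u v k) → IsPath W → 2 ≤ k → Adj G v u → HasCycle G (suc k)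
  path-closing-cycle W W! 2≤k v~u =
    2≤k , vertexAt W , vertexAt-injective W W! , vertexAt-adjacent W ,
    subst (λ y → Adj G y _) (sym (vertexAt-last W)) v~u

  path-prefix : (W : Walk G u v k) → IsPath W → x ∈ vertices W →
    ∃ λ j → j ≤ k × Σ (Walk G u x j) λ W₁ → IsPath W₁ × vertices W₁ ⊆ vertices W
  path-prefix here W! (here refl) = 0 , z≤n , here , W! , id
  path-prefix (step _ _) _ (here refl) = 0 , z≤n , here , [] ∷ [] , λ { (here refl) → here refl }
  path-prefix (step u~y W) (u∉W ∷ W!) (there x∈W) with path-prefix W W! x∈W
  ... | j , j≤k , W₁ , W₁! , W₁⊆W =
    suc j , s≤s j≤k , step u~y W₁ , anti-mono W₁⊆W u∉W ∷ W₁! , ∷⁺ʳ _ W₁⊆W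

  path-suffix : (W : Walk G u v k) → IsPath W → x ∈ vertices W → ∃ λ j → j ≤ k × Σ (Walk G x v j) IsPath
  path-suffix here W! (here refl) = 0 , z≤n , here , W!
  path-suffix W@(step _ _) W! (here refl) = _ , ≤-refl , W , W!
  path-suffix (step _ W) (_ ∷ W!) (there x∈W) with path-suffix W W! x∈W
  ... | j , j≤k , W₂ , W₂! = j , m≤n⇒m≤1+n j≤k , W₂ , W₂!

  walk⇒path : Walk G u v k → ∃ λ j → j ≤ k × Σ (Walk G u v j) IsPath
  walk⇒path here = 0 , z≤n , here , [] ∷ []
  walk⇒path {u} (step u~y W) with walk⇒path W
  ... | j , j≤k , P , P! with u ∈? vertices P
  ...   | yes u∈P =
    let (i , i≤j , Q , Q!) = path-suffix P P! u∈P in i , ≤-trans i≤j (m≤n⇒m≤1+n j≤k) , Q , Q!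
  ...   | no u∉P = suc j , s≤s j≤k , step u~y P , ¬Any⇒All¬ _ u∉P ∷ P!

  GirthAtLeast : ℕ → Set
  GirthAtLeast g = ∀ h → HasCycle G h → g ≤ h

  module _ {g : ℕ} (girth≤ : GirthAtLeast g) where

    girth≤-path-to-neighbour : ∀ {p r p′} (p~r : Adj G p r) (R : Walk G r v k) → IsPath (step p~r R) →
      Adj G p p′ → r ≢ p′ → p′ ∈ vertices R → g ≤ suc (suc k)
    girth≤-path-to-neighbour p~r R (p∉R ∷ R!) p~p′ r≢p′ p′∈R with path-prefix R R! p′∈R
    ... | zero , _ , here , _ = contradiction refl r≢p′
    ... | suc j , 1+j≤k , R₁ , R₁! , R₁⊆R = ≤-trans (girth≤ _ cycle) (s≤s (s≤s 1+j≤k))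
      where
      cycle = path-closing-cycle (step p~r R₁) (anti-mono R₁⊆R p∉R ∷ R₁!) (s≤s (s≤s z≤n)) (adj-sym p~p′)

    -- Step along P: either its next vertex p′ lies on R, closing a cycle through p of length at most
    -- 2 + k, or p′ ∷ p ∷ R is again a path, now diverging from the rest of P at p′.
    diverging-paths-too-short : ∀ {p r p′} (p~r : Adj G p r) (R : Walk G r v k) (p~p′ : Adj G p p′)
      (P : Walk G p′ v l) → r ≢ p′ → IsPath (step p~r R) → IsPath (step p~p′ P) → suc k + suc l < g → ⊥
    diverging-paths-too-short {k = k} {l} {p′ = p′} p~r R p~p′ P r≢p′ R! P! short with p′ ∈? vertices R
    ... | yes p′∈R = <⇒≱ short (≤-trans (girth≤-path-to-neighbour p~r R R! p~p′ r≢p′ p′∈R) 2+k≤1+k+1+l)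
      where
      2+k≤1+k+1+l : 2 + k ≤ suc k + suc l
      2+k≤1+k+1+l = s≤s (≤-trans (s≤s (m≤m+n k l)) (≤-reflexive (sym (+-suc k l))))
    diverging-paths-too-short p~r R p~p′ here r≢p′ R! P! short | no p′∉R = p′∉R (end∈vertices R)
    diverging-paths-too-short {k = k} {suc l} {p′ = p′} p~r R p~p′ (step p′~s P) r≢p′ R! (p∉P ∷ P!) short
      | no p′∉R =
      diverging-paths-too-short (adj-sym p~p′) (step p~r R) p′~s P p≢s (¬Any⇒All¬ _ p′∉pR ∷ R!) P!
        (subst (_< g) (+-suc (suc k) (suc l)) short)
      where
      p≢s = All.lookup p∉P (there (vertexAt∈vertices P zero))
      p′∉pR : p′ ∉ vertices (step p~r R)
      p′∉pR (here p′≡p) = adj⇒≢ p~p′ (sym p′≡p)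
      p′∉pR (there p′∈R) = p′∉R p′∈R

    paths-below-girth-equal-length : (R : Walk G u v k) (P : Walk G u v l) → IsPath R → IsPath P →
      k + l < g → k ≡ l
    paths-below-girth-equal-length here here _ _ _ = refl
    paths-below-girth-equal-length here (step _ P) _ P! _ =
      contradiction (end∈vertices P) (Unique[x∷xs]⇒x∉xs P!)
    paths-below-girth-equal-length (step _ R) here R! _ _ =
      contradiction (end∈vertices R) (Unique[x∷xs]⇒x∉xs R!)
    paths-below-girth-equal-length {k = suc k} {suc l} (step {w = r} p~r R) (step {w = p′} p~p′ P) R! P! short
      with r ≟ p′
    ... | yes refl = cong suc (paths-below-girth-equal-length R P (tail R!) (tail P!) shorter)
      where
      shorter : k + l < g
      shorter = <-trans (+-monoʳ-< k (n<1+n l)) (<-trans (n<1+n _) short)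
    ... | no r≢p′ = ⊥-elim (diverging-paths-too-short p~r R p~p′ P r≢p′ R! P! short)

    path-≤-walk : ∀ {t m} (P : Walk G u v t) → IsPath P → (W : Walk G u v m) → t + m < g → t ≤ m
    path-≤-walk {t = t} P P! W short with walk⇒path W
    ... | j , j≤m , Q , Q! =
      subst (_≤ _) (sym (paths-below-girth-equal-length P Q P! Q! (≤-<-trans (+-monoʳ-≤ t j≤m) short))) j≤m

  walk? : ∀ u v k → Dec (Walk G u v k)
  walk? u v zero with u ≟ v
  ... | yes refl = yes here
  ... | no u≢v = no λ { here → u≢v refl }
  walk? u v (suc k) with any? (λ w → T? (Graph.adj G u w) ×-dec walk? w v k)
  ... | yes (w , u~w , W) = yes (step u~w W)
  ... | no ∄w = no λ { (step u~w W) → ∄w (_ , u~w , W) }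

  distance : Connected G → ∀ u v → ∃ (IsDist G u v)
  distance connected u v = least-witness (walk? u v) (proj₂ (connected u v))

  distance-self : IsDist G u u k → k ≡ 0
  distance-self (_ , least) = n≤0⇒n≡0 (least 0 here)

  SameRepresentation : Subset n → Fin n → Fin n → Set
  SameRepresentation W u v = ∀ w → w ∈ₛ W → ∀ k → IsDist G u w k → IsDist G v w k

  resolving-outside : Connected G → ∀ {W} →
    (∀ u v → u ∉ₛ W → v ∉ₛ W → SameRepresentation W u v → u ≡ v) → Resolving G W
  resolving-outside connected {W} resolves-outside u v same with u ∈ₛ? W | v ∈ₛ? W
  ... | yes u∈W | _ = sym (walk₀⇒≡ (proj₁ (same u u∈W 0 (here , λ _ _ → z≤n))))
  ... | no _ | yes v∈W with distance connected u v
  ...   | k , d[u,v] = walk₀⇒≡ (subst (Walk G u v) (distance-self (same v v∈W k d[u,v])) (proj₁ d[u,v]))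
  resolving-outside _ resolves-outside u v same | no u∉W | no v∉W = resolves-outside u v u∉W v∉W same

  resolving-of-size≤dim⇒basis : ∀ {b S} → MetricDim G b → Resolving G S → ∣ S ∣ ≤ b → MetricBasis G S
  resolving-of-size≤dim⇒basis (_ , (_ , minimal) , refl) resolving ∣S∣≤b =
    resolving , λ W′ W′-resolving → ≤-trans ∣S∣≤b (minimal W′ W′-resolving)

  record Cycle (g : ℕ) : Set where
    field
      vertex   : ℕ → Fin n
      adjacent : ∀ k → Adj G (vertex k) (vertex (suc k))
      periodic : ∀ k → vertex (k + g) ≡ vertex k
      distinct : ∀ {i j} → i < j → j < i + g → vertex i ≢ vertex j

  rotate : ∀ {g} → Cycle g → Cycle g
  rotate C = record
    { vertex = vertex ∘ suc
    ; adjacent = adjacent ∘ suc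
    ; periodic = periodic ∘ suc
    ; distinct = λ i<j j<i+g → distinct (s≤s i<j) (s≤s j<i+g)
    }
    where open Cycle C

  hasCycle⇒cycle : ∀ {g} → HasCycle G g → Cycle g
  hasCycle⇒cycle {suc m} (_ , f , f-injective , f-adjacent , f-closing) = record
    { vertex = vertex
    ; adjacent = adjacent
    ; periodic = λ k → cong f (index-≡ (k + g) (index k) (trans (toℕ-index k) (sym ([m+n]%n≡m%n k g))))
    ; distinct = λ {i} {j} i<j j<i+g fi≡fj → %-injective-window g i<j j<i+g
        (trans (sym (toℕ-index i)) (trans (cong toℕ (f-injective fi≡fj)) (toℕ-index j)))
    }
    where
    g = suc m
    index : ℕ → Fin g
    index k = fromℕ< (m%n<n k g)
    toℕ-index : ∀ k → toℕ (index k) ≡ k % g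
    toℕ-index k = toℕ-fromℕ< (m%n<n k g)
    index-≡ : ∀ k i → toℕ i ≡ k % g → index k ≡ i
    index-≡ k i eq = toℕ-injective (trans (toℕ-index k) (sym eq))
    vertex : ℕ → Fin n
    vertex = f ∘ index
    adjacent : ∀ k → Adj G (vertex k) (vertex (suc k))
    adjacent k with m≤n⇒m<n∨m≡n (m%n<n k g)
    ... | inj₁ 1+r<g = subst₂ (λ i j → Adj G (f i) (f j))
      (sym (index-≡ k (inject₁ j) toℕ-j)) (sym (index-≡ (suc k) (suc j) toℕ-suc-j)) (f-adjacent j)
      where
      j = fromℕ< (≤-pred 1+r<g)
      toℕ-j : toℕ (inject₁ j) ≡ k % g
      toℕ-j = trans (toℕ-inject₁ j) (toℕ-fromℕ< _)
      toℕ-suc-j : suc (toℕ j) ≡ suc k % g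
      toℕ-suc-j = trans (cong suc (toℕ-fromℕ< _)) (sym (trans ([1+m]%n≡[1+m%n]%n k g) (m<n⇒m%n≡m 1+r<g)))
    ... | inj₂ 1+r≡g = subst₂ (λ i j → Adj G (f i) (f j))
      (sym (index-≡ k (fromℕ m) toℕ-last)) (sym (index-≡ (suc k) zero toℕ-first)) f-closing
      where
      toℕ-last : toℕ (fromℕ m) ≡ k % g
      toℕ-last = trans (toℕ-fromℕ m) (sym (suc-injective 1+r≡g))
      toℕ-first : 0 ≡ suc k % g
      toℕ-first = sym (trans ([1+m]%n≡[1+m%n]%n k g) (trans (cong (_% g) 1+r≡g) (n%n≡0 g)))

  module _ {g : ℕ} (C : Cycle g) where
    open Cycle C

    arc : ∀ a t → Walk G (vertex a) (vertex (t + a)) t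
    arc a = walk-along (λ d → vertex (d + a)) (λ d → adjacent (d + a))

    arc-isPath : ∀ a {t} → t < g → IsPath (arc a t)
    arc-isPath a {t} t<g =
      subst Unique (sym (vertices-walk-along _ _ t)) (applyUpTo⁺₁ _ (suc t) within-window)
      where
      within-window : ∀ {i j} → i < j → j < suc t → vertex (i + a) ≢ vertex (j + a)
      within-window {i} {j} i<j j≤t = distinct (+-monoˡ-< a i<j) (begin-strict
        j + a       <⟨ +-monoˡ-< a (<-≤-trans j≤t t<g) ⟩
        g + a       ≡⟨ +-comm g a ⟩
        a + g       ≤⟨ +-monoˡ-≤ g (m≤n+m a i) ⟩
        i + a + g   ∎)
        where open ≤-Reasoning

    cycle-distance : GirthAtLeast g → ∀ {a t s k} → t + s ≡ g →
      IsDist G (vertex a) (vertex (t + a)) k → k ≡ t ⊓ s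
    cycle-distance girth≤ {a} {t} {s} {k} t+s≡g (W , least) =
      ≤-antisym (⊓-glb (least t (arc a t)) (least s around)) t⊓s≤k
      where
      around : Walk G (vertex a) (vertex (t + a)) s
      around = subst (λ y → Walk G y (vertex (t + a)) s) (trans (cong vertex s+t+a≡a+g) (periodic a))
        (walk-reverse (arc (t + a) s))
        where
        s+t+a≡a+g : s + (t + a) ≡ a + g
        s+t+a≡a+g = trans (sym (+-assoc s t a)) (trans (cong (_+ a) (trans (+-comm s t) t+s≡g)) (+-comm g a))
      t⊓s≤k : t ⊓ s ≤ k
      t⊓s≤k with t + k <? g
      ... | yes t+k<g =
        ≤-trans (m⊓n≤m t s) (path-≤-walk girth≤ (arc a t) (arc-isPath a (≤-<-trans (m≤m+n t k) t+k<g)) W t+k<g)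
      ... | no t+k≮g = ≤-trans (m⊓n≤n t s) (+-cancelˡ-≤ t s k (subst (_≤ t + k) (sym t+s≡g) (≮⇒≥ t+k≮g)))

  -- S omits the cycle vertices 1, …, q and keeps the landmarks 0 and q + 1, adjacent on the cycle.
  module Landmarks (connected : Connected G) {q : ℕ} (C : Cycle (2 + q))
                   (girth≤ : GirthAtLeast (2 + q)) where
    open Cycle C

    interior : List (Fin n)
    interior = applyUpTo (vertex ∘ suc) q

    S : Subset n
    S = ⊤ ∖ interior

    ∣S∣+q≤n : ∣ S ∣ + q ≤ n
    ∣S∣+q≤n = subst₂ (λ l m → ∣ S ∣ + l ≤ m) (length-applyUpTo _ q) (∣⊤∣≡n n)
      (∣∖∣+length≤∣∣ ⊤ interior-unique (All.tabulate (λ _ → ∈⊤)))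
      where
      interior-unique : Unique interior
      interior-unique = applyUpTo⁺₁ _ q λ i<j j<q →
        distinct (s≤s i<j) (s≤s (<-≤-trans j<q (≤-trans (m≤n+m q 2) (m≤n+m (2 + q) _))))

    off-interior⇒∈S : ∀ c → (∀ {d} → d < q → vertex c ≢ vertex (suc d)) → vertex c ∈ₛ S
    off-interior⇒∈S c off = ∈-∖⁺ interior ∈⊤ λ c∈ →
      let (d , d<q , eq) = ∈-applyUpTo⁻ _ c∈ in off d<q eq

    first-landmark∈S : vertex 0 ∈ₛ S
    first-landmark∈S = off-interior⇒∈S 0 λ d<q → distinct (s≤s z≤n) (s≤s (m<n⇒m<1+n d<q))

    second-landmark∈S : vertex (suc q) ∈ₛ S
    second-landmark∈S = off-interior⇒∈S (suc q) λ {d} d<q eq →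
      distinct (s≤s d<q) (s≤s (≤-trans (n≤1+n (suc q)) (m≤n+m (2 + q) d))) (sym eq)

    vertex₁∉S : 1 ≤ q → vertex 1 ∉ₛ S
    vertex₁∉S 0<q = ∈⇒∉-∖ ⊤ (∈-applyUpTo⁺ (vertex ∘ suc) 0<q)

    position : ∀ {u} → u ∉ₛ S → ∃₂ λ i e → e + i ≡ suc q × u ≡ vertex i
    position u∉S with ∈-applyUpTo⁻ _ (∉-∖⁻ interior ∈⊤ u∉S)
    ... | d , d<q , refl = suc d , q ∸ d , trans (+-suc (q ∸ d) d) (cong suc (m∸n+n≡m (<⇒≤ d<q))) , refl

    landmark-distances : ∀ {i e k₀ k₁} → e + i ≡ suc q →
      IsDist G (vertex i) (vertex 0) k₀ → IsDist G (vertex i) (vertex (suc q)) k₁ →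
      k₀ ≡ suc e ⊓ i × k₁ ≡ e ⊓ suc i
    landmark-distances {i} {e} {k₀} {k₁} e+i≡1+q d₀ d₁ =
      cycle-distance C girth≤ (cong suc e+i≡1+q) (subst (λ y → IsDist G (vertex i) y k₀) 0≡1+e+i d₀) ,
      cycle-distance C girth≤ (trans (+-suc e i) (cong suc e+i≡1+q))
        (subst (λ y → IsDist G (vertex i) y k₁) (cong vertex (sym e+i≡1+q)) d₁)
      where
      0≡1+e+i : vertex 0 ≡ vertex (suc e + i)
      0≡1+e+i = sym (trans (cong (vertex ∘ suc) e+i≡1+q) (periodic 0))

    resolving : Resolving G S
    resolving = resolving-outside connected resolves-outside
      where
      resolves-outside : ∀ u v → u ∉ₛ S → v ∉ₛ S → SameRepresentation S u v → u ≡ v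
      resolves-outside u v u∉S v∉S same with position u∉S | position v∉S
      ... | i , e , e+i , refl | j , e′ , e′+j , refl =
        cong vertex (two-adjacent-landmarks-resolve (trans e+i (sym e′+j))
          (trans (sym (proj₁ dᵢ)) (proj₁ dⱼ)) (trans (sym (proj₂ dᵢ)) (proj₂ dⱼ)))
        where
        D₀ = distance connected (vertex i) (vertex 0)
        D₁ = distance connected (vertex i) (vertex (suc q))
        dᵢ = landmark-distances e+i (proj₂ D₀) (proj₂ D₁)
        dⱼ = landmark-distances e′+j (same _ first-landmark∈S _ (proj₂ D₀))
                                     (same _ second-landmark∈S _ (proj₂ D₁))

    basis : ∀ {b} → MetricDim G b → 2 + q ≤ n → n ∸ (2 + q) + 1 < b → MetricBasis G S
    basis {b} dim g≤n n-g+1<b = resolving-of-size≤dim⇒basis dim resolving (begin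
      ∣ S ∣                 ≤⟨ +-cancelʳ-≤ q ∣ S ∣ _ (subst (∣ S ∣ + q ≤_) n≡ ∣S∣+q≤n) ⟩
      n ∸ (2 + q) + 2       ≡⟨ +-suc (n ∸ (2 + q)) 1 ⟩
      suc (n ∸ (2 + q) + 1) ≤⟨ n-g+1<b ⟩
      b                     ∎)
      where
      open ≤-Reasoning
      n≡ : n ≡ n ∸ (2 + q) + 2 + q
      n≡ = trans (sym (m∸n+n≡m g≤n)) (sym (+-assoc (n ∸ (2 + q)) 2 q))

theorem2 : (n : ℕ) (G : Graph n) → Connected G → UniquelyDimensional G →
    (g : ℕ) → Girth G g → (b : ℕ) → MetricDim G b → b ≤ n ∸ g + 1
theorem2 n G connected (_ , _ , unique) g@(suc (suc (suc _)))
  (cycle@(s≤s (s≤s z≤n) , _ , f-injective , _) , girth≤) b dim with b ≤? n ∸ g + 1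
... | yes b≤n-g+1 = b≤n-g+1
... | no b≰n-g+1 = ⊥-elim (L₁.vertex₁∉S (s≤s z≤n) (subst (Cycle.vertex C 1 ∈ₛ_) S₂≡S₁ L₂.first-landmark∈S))
  where
  C = hasCycle⇒cycle G cycle
  module L₁ = Landmarks G connected C girth≤
  module L₂ = Landmarks G connected (rotate G C) girth≤
  g≤n = injective⇒≤ f-injective
  n-g+1<b = ≰⇒> b≰n-g+1
  S₂≡S₁ : L₂.S ≡ L₁.S
  S₂≡S₁ = trans (unique _ (L₂.basis dim g≤n n-g+1<b)) (sym (unique _ (L₁.basis dim g≤n n-g+1<b)))
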